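{- Let $G$ be a strongly $2$-monophonic graph having two non-adjacent simplicial vertices $x$ and $y$. Then every vertex $z\in V(G)\setminus\{x,y\}$ has degree $n(G)-1$, where $n(G)=|V(G)|$. In particular, $G-\{x,y\}$ is a complete graph.
   Context: All graphs are finite and simple. A vertex $v$ is simplicial if $N[v]$ induces a complete graph. For a graph $G$ and $u,v\in V(G)$, the monophonic interval $J_G(u,v)$ is the set of all vertices lying on some induced $u,v$-path in $G$, with the convention $u,v\in J_G(u,v)$ and $J_G(u,u)=\{u\}$. A set $S\subseteq V(G)$ is monophonic if for every $w\in V(G)$ there exist $x,y\in S$ with $w\in J_G(x,y)$; $m(G)$ is the minimum size of a monophonic set. $G$ is $2$-monophonic if $m(G)=2$, and strongly $2$-monophonic if it is $2$-monophonic and $\{x,y\}$ is a monophonic set for every pair of non-adjacent vertices $x,y$. -}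

module Defs where

open import Data.Nat using (ℕ; zero; suc; _∸_; _≤_)
open import Data.Fin using (Fin; toℕ; fromℕ)
import Data.Fin as F
open import Data.Fin.Subset using (Subset; _∈_; ∣_∣; ⁅_⁆; _∪_)
open import Data.Vec using (tabulate)
open import Data.Product using (Σ; ∃; ∃-syntax; _×_)
open import Data.Sum using (_⊎_)
open import Data.Empty using (⊥)
open import Relation.Nullary using (¬_; Dec)
open import Relation.Nullary.Decidable using (⌊_⌋)
open import Relation.Binary.PropositionalEquality using (_≡_; _≢_)
open import Function.Definitions using (Injective)

record Graph (n : ℕ) : Set₁ where
  field
    Adj    : Fin n → Fin n → Set
    adj?   : ∀ u v → Dec (Adj u v)
    sym    : ∀ {u v} → Adj u v → Adj v u
    irrefl : ∀ {u} → ¬ Adj u u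
open Graph public

module _ {n : ℕ} (G : Graph n) where

  InClosedNbhd : Fin n → Fin n → Set
  InClosedNbhd v a = a ≡ v ⊎ Adj G v a

  Simplicial : Fin n → Set
  Simplicial v = ∀ a b → InClosedNbhd v a → InClosedNbhd v b → a ≢ b → Adj G a b

  degree : Fin n → ℕ
  degree v = ∣ tabulate (λ u → ⌊ adj? G v u ⌋) ∣

  record InducedPath (u v : Fin n) : Set where
    field
      len      : ℕ
      vtx      : Fin (suc len) → Fin n
      distinct : Injective _≡_ _≡_ vtx
      start    : vtx F.zero ≡ u
      end      : vtx (fromℕ len) ≡ v
      consec   : ∀ i j → toℕ j ≡ suc (toℕ i) → Adj G (vtx i) (vtx j)
      chordless : ∀ i j → Adj G (vtx i) (vtx j) →
                   toℕ j ≡ suc (toℕ i) ⊎ toℕ i ≡ suc (toℕ j)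

  -- w ∈ J_G(u,v): w lies on some induced u,v-path (with u,v ∈ J_G(u,v) by convention)
  InInterval : Fin n → Fin n → Fin n → Set
  InInterval w u v = w ≡ u ⊎ w ≡ v ⊎
    Σ (InducedPath u v) (λ P → ∃[ i ] InducedPath.vtx P i ≡ w)

  Monophonic : Subset n → Set
  Monophonic S = ∀ w → ∃[ x ] ∃[ y ] (x ∈ S × y ∈ S × InInterval w x y)

  TwoMonophonic : Set
  TwoMonophonic = (∃[ S ] (Monophonic S × ∣ S ∣ ≡ 2))
                × (∀ S → Monophonic S → 2 ≤ ∣ S ∣)

  StronglyTwoMonophonic : Set
  StronglyTwoMonophonic = TwoMonophonic ×
    (∀ x y → x ≢ y → ¬ Adj G x y → Monophonic (⁅ x ⁆ ∪ ⁅ y ⁆))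

-- A simplicial vertex is never an interior vertex of an induced path: its two
-- neighbours on the path would be adjacent, giving a chord.  Hence a simplicial
-- vertex lies in J(a,b) only if it is a or b.  If some z ∉ {x,y} were non-adjacent
-- to a vertex w ≠ z, strong 2-monophonicity would make {z,w} monophonic, so both
-- simplicial vertices x and y would lie in {z,w} ∖ {z} = {w}, contradicting x ≢ y.
module Submission where

open import Defs hiding (sym)
open import Data.Nat using (ℕ; _∸_; suc)
open import Data.Nat.Properties using (1+n≢n; m+1+n≢n; _≟_)
open import Data.Fin as Fin using (Fin; toℕ; fromℕ; inject₁; lower₁)
open import Data.Fin.Properties using (toℕ-injective; toℕ-fromℕ; toℕ-inject₁; toℕ-lower₁)
open import Data.Fin.Subset using (Subset; _∈_; ⁅_⁆; _∪_; ∁; ∣_∣)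
open import Data.Fin.Subset.Properties
  using (x∈p∪q⁻; x∈⁅y⁆⇒x≡y; x≢y⇒x∉⁅y⁆; x∉⁅y⁆⇒x≢y; x∉p⇒x∈∁p; x∈∁p⇒x∉p; ⊆-antisym; ∣∁p∣≡n∸∣p∣; ∣⁅x⁆∣≡1)
open import Data.Vec using (tabulate)
open import Data.Vec.Properties using (lookup∘tabulate; []=⇒lookup; lookup⇒[]=)
open import Data.Product using (_×_; _,_)
open import Data.Sum as Sum using (_⊎_; inj₁; inj₂; [_,_])
open import Relation.Nullary using (¬_; yes; no)
open import Relation.Nullary.Decidable using (⌊_⌋; isYes≗does; dec-true; decidable-stable)
open import Relation.Binary.PropositionalEquality
  using (_≡_; _≢_; refl; sym; trans; cong; ≢-sym; module ≡-Reasoning)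
open import Data.Empty using (⊥; ⊥-elim)

x∈⁅a⁆∪⁅b⁆⇒x≡a⊎x≡b : ∀ {n} {x a b : Fin n} → x ∈ ⁅ a ⁆ ∪ ⁅ b ⁆ → x ≡ a ⊎ x ≡ b
x∈⁅a⁆∪⁅b⁆⇒x≡a⊎x≡b {a = a} {b} x∈ = Sum.map (x∈⁅y⁆⇒x≡y a) (x∈⁅y⁆⇒x≡y b) (x∈p∪q⁻ ⁅ a ⁆ ⁅ b ⁆ x∈)

module _ {n : ℕ} (G : Graph n) where

  neighbourhood : Fin n → Subset n
  neighbourhood v = tabulate (λ u → ⌊ adj? G v u ⌋)

  adj⇒∈neighbourhood : ∀ {v u} → Adj G v u → u ∈ neighbourhood v
  adj⇒∈neighbourhood {v} {u} vu =
    lookup⇒[]= u _ (trans (lookup∘tabulate _ u) (trans (isYes≗does (adj? G v u)) (dec-true (adj? G v u) vu)))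

  ∈neighbourhood⇒adj : ∀ {v u} → u ∈ neighbourhood v → Adj G v u
  ∈neighbourhood⇒adj {v} {u} u∈N with adj? G v u | trans (sym (lookup∘tabulate _ u)) ([]=⇒lookup u∈N)
  ... | yes vu | _  = vu
  ... | no _   | ()

  neighbourhood-universal : ∀ {v} → (∀ u → u ≢ v → Adj G v u) → neighbourhood v ≡ ∁ ⁅ v ⁆
  neighbourhood-universal {v} universal = ⊆-antisym
    (λ u∈N → x∉p⇒x∈∁p (x≢y⇒x∉⁅y⁆ λ { refl → irrefl G (∈neighbourhood⇒adj u∈N) }))
    (λ {u} u∈∁ → adj⇒∈neighbourhood (universal u (x∉⁅y⁆⇒x≢y (x∈∁p⇒x∉p u∈∁))))

  degree-universal : ∀ {v} → (∀ u → u ≢ v → Adj G v u) → degree G v ≡ n ∸ 1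
  degree-universal {v} universal = begin
    ∣ neighbourhood v ∣ ≡⟨ cong ∣_∣ (neighbourhood-universal universal) ⟩
    ∣ ∁ ⁅ v ⁆ ∣         ≡⟨ ∣∁p∣≡n∸∣p∣ ⁅ v ⁆ ⟩
    n ∸ ∣ ⁅ v ⁆ ∣       ≡⟨ cong (n ∸_) (∣⁅x⁆∣≡1 v) ⟩
    n ∸ 1               ∎
    where open ≡-Reasoning

  module _ {u v : Fin n} (P : InducedPath G u v) where
    open InducedPath P

    interior-¬simplicial : (k : Fin len) → len ≢ suc (toℕ k) → ¬ Simplicial G (vtx (Fin.suc k))
    interior-¬simplicial k not-last simplicial =
      [ next≢1+prev , prev≢1+next ] (chordless prev next prev~next)
      where
        prev next : Fin (suc len)
        prev = inject₁ k
        next = Fin.suc (lower₁ (Fin.suc k) not-last)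

        toℕ-prev : toℕ prev ≡ toℕ k
        toℕ-prev = toℕ-inject₁ k

        toℕ-next : toℕ next ≡ suc (suc (toℕ k))
        toℕ-next = cong suc (toℕ-lower₁ (Fin.suc k) not-last)

        prev≢next : vtx prev ≢ vtx next
        prev≢next eq = m+1+n≢n 1 (trans (sym toℕ-next) (trans (cong toℕ (sym (distinct eq))) toℕ-prev))

        prev~next : Adj G (vtx prev) (vtx next)
        prev~next = simplicial _ _
          (inj₂ (Graph.sym G (consec prev (Fin.suc k) (cong suc (sym toℕ-prev)))))
          (inj₂ (consec (Fin.suc k) next toℕ-next))
          prev≢next

        next≢1+prev : toℕ next ≢ suc (toℕ prev)
        next≢1+prev eq = 1+n≢n (trans (sym toℕ-next) (trans eq (cong suc toℕ-prev)))

        prev≢1+next : toℕ prev ≢ suc (toℕ next)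
        prev≢1+next eq = m+1+n≢n 2 (trans (cong suc (sym toℕ-next)) (trans (sym eq) toℕ-prev))

  simplicial∉interval : ∀ {s u v} → Simplicial G s → s ≢ u → s ≢ v → ¬ InInterval G s u v
  simplicial∉interval _ s≢u _ (inj₁ s≡u) = s≢u s≡u
  simplicial∉interval _ _ s≢v (inj₂ (inj₁ s≡v)) = s≢v s≡v
  simplicial∉interval _ s≢u _ (inj₂ (inj₂ (P , Fin.zero , refl))) = s≢u (InducedPath.start P)
  simplicial∉interval simplicial _ s≢v (inj₂ (inj₂ (P , Fin.suc k , refl)))
    with InducedPath.len P ≟ suc (toℕ k)
  ... | no not-last = interior-¬simplicial P k not-last simplicial
  ... | yes last = s≢v (trans (cong (InducedPath.vtx P) suc-k≡last) (InducedPath.end P))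
    where
      suc-k≡last : Fin.suc k ≡ fromℕ (InducedPath.len P)
      suc-k≡last = toℕ-injective (trans (sym last) (sym (toℕ-fromℕ _)))

  simplicial∈monophonicPair : ∀ {a b s} → Monophonic G (⁅ a ⁆ ∪ ⁅ b ⁆) → Simplicial G s → s ≡ a ⊎ s ≡ b
  simplicial∈monophonicPair {s = s} monophonic simplicial
    with monophonic s
  ... | x , y , x∈pair , y∈pair , s∈J with s Fin.≟ x | s Fin.≟ y
  ...   | yes refl | _        = x∈⁅a⁆∪⁅b⁆⇒x≡a⊎x≡b x∈pair
  ...   | no _     | yes refl = x∈⁅a⁆∪⁅b⁆⇒x≡a⊎x≡b y∈pair
  ...   | no s≢x   | no s≢y   = ⊥-elim (simplicial∉interval simplicial s≢x s≢y s∈J)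

  adjacent-to-all : StronglyTwoMonophonic G → ∀ {x y} → x ≢ y → Simplicial G x → Simplicial G y →
                    ∀ {z} → z ≢ x → z ≢ y → ∀ w → w ≢ z → Adj G z w
  adjacent-to-all (_ , pairs-monophonic) {x} {y} x≢y simplicial-x simplicial-y {z} z≢x z≢y w w≢z =
    decidable-stable (adj? G z w) ¬¬adj
    where
      exclude : x ≡ z ⊎ x ≡ w → y ≡ z ⊎ y ≡ w → ⊥
      exclude (inj₁ x≡z) _          = z≢x (sym x≡z)
      exclude _          (inj₁ y≡z) = z≢y (sym y≡z)
      exclude (inj₂ x≡w) (inj₂ y≡w) = x≢y (trans x≡w (sym y≡w))

      ¬¬adj : ¬ ¬ Adj G z w
      ¬¬adj ¬adj = exclude (simplicial∈zw simplicial-x) (simplicial∈zw simplicial-y)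
        where
          simplicial∈zw : ∀ {s} → Simplicial G s → s ≡ z ⊎ s ≡ w
          simplicial∈zw = simplicial∈monophonicPair (pairs-monophonic z w (≢-sym w≢z) ¬adj)

proposition3p5 : (n : ℕ) (G : Graph n) → StronglyTwoMonophonic G →
    (x y : Fin n) → x ≢ y → ¬ Adj G x y → Simplicial G x → Simplicial G y →
    (∀ z → z ≢ x → z ≢ y → degree G z ≡ n ∸ 1)
    × (∀ a b → a ≢ x → a ≢ y → b ≢ x → b ≢ y → a ≢ b → Adj G a b)
proposition3p5 n G strong x y x≢y _ simplicial-x simplicial-y =
  (λ z z≢x z≢y → degree-universal G (universal z≢x z≢y)) ,
  (λ a b a≢x a≢y _ _ a≢b → universal a≢x a≢y b (≢-sym a≢b))
  where
    universal : ∀ {z} → z ≢ x → z ≢ y → ∀ w → w ≢ z → Adj G z w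
    universal = adjacent-to-all G strong x≢y simplicial-x simplicial-y
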